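{- Let $k\geq 1$ be an integer, let $G$ be a graph of treewidth at most $k$, and let $s,t\in V(G)$ be distinct and non-adjacent. Assume that every tree decomposition of $G$ of width at most $k$ has a bag containing both $s$ and $t$. Then there exists a tree decomposition $(\mathcal{B},\mathcal{T})$ of $G$ of width $k$ and an edge $ij\in E(\mathcal{T})$ such that $s,t\in B_i\cap B_j$, $|B_i\cap B_j|\leq k$, and $G-(B_i\cap B_j)$ is not connected. In particular, $s$ and $t$ are contained in a vertex-separator of $G$ with at most $k$ vertices.
   Context: Graphs are finite and may contain parallel edges but no loops. A tree decomposition $(\mathcal{B},\mathcal{T})$ of $G$ consists of a tree $\mathcal{T}$ and bags $B_i\subseteq V(G)$, $i\in V(\mathcal{T})$, covering $V(G)$, such that every edge has both ends in some bag and, for each vertex, the nodes whose bags contain it form a connected subtree; its width is the maximum bag size minus one, and the treewidth of $G$ is the minimum width of a tree decomposition. A set $W\subseteq V(G)$ is a vertex-separator if $G-W$ is not connected. -}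

module Defs where

open import Data.Nat using (ℕ; _≤_; _<_; _+_)
open import Data.Fin using (Fin)
open import Data.Fin.Subset using (Subset; _∈_; _∉_; _∩_; ∣_∣)
open import Data.List using (List; []; _∷_; _++_; [_]; length)
import Data.List.Membership.Propositional as LM
open import Data.List.Relation.Unary.All using (All)
open import Data.List.Relation.Unary.Unique.Propositional using (Unique)
open import Data.Product using (Σ; ∃; _×_; _,_; proj₁; proj₂)
open import Data.Sum using (_⊎_)
open import Data.Unit using (⊤)
open import Relation.Nullary using (¬_)
open import Relation.Binary.PropositionalEquality using (_≡_; _≢_)

-- A finite multigraph on vertex set Fin n: a list of edges (parallel edges
-- allowed as repeated list entries), without loops.
record Graph (n : ℕ) : Set where
  field
    edges    : List (Fin n × Fin n)
    loopless : All (λ e → proj₁ e ≢ proj₂ e) edges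
open Graph public

Adj : ∀ {n} → Graph n → Fin n → Fin n → Set
Adj G u v = ((u , v) LM.∈ edges G) ⊎ ((v , u) LM.∈ edges G)

data Walk {A : Set} (R : A → A → Set) (P : A → Set) : A → A → Set where
  here : ∀ {u} → P u → Walk R P u u
  step : ∀ {u w v} → P u → R u w → Walk R P w v → Walk R P u v

Chain : {A : Set} → (A → A → Set) → List A → Set
Chain R []           = ⊤
Chain R (x ∷ [])     = ⊤
Chain R (x ∷ y ∷ xs) = R x y × Chain R (y ∷ xs)

-- a cycle x, xs₁, …, xsₗ, x with l ≥ 2 (so at least 3 distinct vertices)
HasCycle : {A : Set} → (A → A → Set) → Set
HasCycle {A} R = Σ A λ x → Σ (List A) λ xs →
  (2 ≤ length xs) × Unique (x ∷ xs) × Chain R (x ∷ xs ++ [ x ])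

record IsTree {m : ℕ} (TAdj : Fin m → Fin m → Set) : Set where
  field
    nonempty  : 0 < m
    symmetric : ∀ i j → TAdj i j → TAdj j i
    irreflex  : ∀ i → ¬ TAdj i i
    connected : ∀ i j → Walk TAdj (λ _ → ⊤) i j
    acyclic   : ¬ HasCycle TAdj

record TreeDecomposition {n : ℕ} (G : Graph n) : Set₁ where
  field
    m         : ℕ
    TAdj      : Fin m → Fin m → Set
    isTree    : IsTree TAdj
    bag       : Fin m → Subset n
    covers    : ∀ v → ∃ λ i → v ∈ bag i
    edgeCover : ∀ u v → (u , v) LM.∈ edges G → ∃ λ i → (u ∈ bag i) × (v ∈ bag i)
    subtree   : ∀ v i j → v ∈ bag i → v ∈ bag j → Walk TAdj (λ l → v ∈ bag l) i j
open TreeDecomposition public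

-- width ≤ k  ⇔  every bag has at most k + 1 vertices
WidthAtMost : ∀ {n} {G : Graph n} → TreeDecomposition G → ℕ → Set
WidthAtMost D k = ∀ i → ∣ bag D i ∣ ≤ k + 1

WidthEq : ∀ {n} {G : Graph n} → TreeDecomposition G → ℕ → Set
WidthEq D k = WidthAtMost D k × ∃ λ i → ∣ bag D i ∣ ≡ k + 1

TreewidthAtMost : ∀ {n} → Graph n → ℕ → Set₁
TreewidthAtMost G k = Σ (TreeDecomposition G) λ D → WidthAtMost D k

ConnectedMinus : ∀ {n} → Graph n → Subset n → Set
ConnectedMinus G W = ∀ u v → u ∉ W → v ∉ W → Walk (Adj G) (λ x → x ∉ W) u v

IsVertexSeparator : ∀ {n} → Graph n → Subset n → Set
IsVertexSeparator G W = ¬ ConnectedMinus G W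

-- Take a decomposition of width ≤ k and a bag B = B_x of maximum
-- size among the bags containing s and t.
--  (1) Splitting: if some S ⊆ B \ {s, t} separated s from t, cutting the
--      decomposition along the component of s in G - S would give one of
--      width ≤ k with s and t in no common bag.  Hence some component C of
--      G - B is adjacent to both s and t (a "detour" around B).
--  (2) Let W = N(C) ∩ B, so s, t ∈ W.  If W = B, the bags meeting C all lie
--      on one side of a tree edge wz with B_w = B, forcing B ⊊ B_z against
--      maximality; so W ⊊ B, |W| ≤ k, and W separates C from B \ W.
--  (3) Padding: add vertices to bags, keeping W ⊆ B_x, until some bag has
--      exactly k + 1 vertices; then attach a new leaf with bag W to x.
module Submission where

open import Defs
open import Function using (_∘_)
open import Data.Bool using (true; false; if_then_else_)
import Data.Bool.Properties as BoolP
open import Data.Nat using (ℕ; zero; suc; _≤_; _<_; z≤n; s≤s; _+_; _*_; _∸_; _≤?_)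
open import Data.Nat.Properties using (≤-refl; ≤-trans; ≤-reflexive; <⇒≤; ≰⇒>; <⇒≱; ≤⇒≯;
  ≤-pred; <-≤-trans; <-irrefl; n≤1+n; m≤m+n; m<m+n; ≤∧≢⇒<; +-comm; +-suc;
  *-identityʳ; *-distribˡ-+; +-mono-≤; +-mono-<-≤; +-mono-≤-<; ∸-monoʳ-<; m<n⇒0<n∸m)
import Data.Nat.Properties as ℕP
open import Data.Fin using (Fin; zero; suc; _≟_; splitAt; join)
open import Data.Fin.Properties using (any?; splitAt-join; join-splitAt)
open import Data.Fin.Subset using (Subset; _∈_; _∉_; _∪_; _∩_; ∁; ⁅_⁆; ∣_∣; _⊆_; inside; outside)
open import Data.Fin.Subset.Properties using (_∈?_; x∈p∪q⁻; x∈p∪q⁺; x∈p∩q⁺; x∈p∩q⁻;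
  x∈⁅y⁆⇒x≡y; x∈⁅x⁆; ∣p∣≤∣x∷p∣; p⊂q⇒∣p∣<∣q∣; p⊆q⇒∣p∣≤∣q∣; ∣p∣≤n; p⊆p∪q; p∩q⊆q; ∣p∩q∣≤∣p∣; ⊆-antisym;
  x∈∁p⇒x∉p; x∉p⇒x∈∁p)
open import Data.Vec using (_∷_; tabulate)
import Data.Vec as Vec
open import Data.Vec.Properties using (lookup∘tabulate; lookup⇒[]=; []=⇒lookup)
import Data.Vec.Properties as VecP
open import Data.Product using (Σ; ∃; _×_; _,_; proj₁; proj₂)
import Data.Product.Properties as ProdP
open import Data.Sum using (_⊎_; inj₁; inj₂)
import Data.Sum.Properties as SumP
open import Data.Empty using (⊥; ⊥-elim)
open import Data.Unit using (⊤; tt)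
open import Data.List using (List; []; _∷_; _++_; [_]; length; map)
open import Data.List.Properties using (++-assoc; map-++; length-map; length-++)
open import Data.List.Relation.Unary.All using (All; []; _∷_)
import Data.List.Relation.Unary.All as All
import Data.List.Relation.Unary.All.Properties as AllP
open import Data.List.Relation.Unary.Any using (here; there)
open import Data.List.Relation.Unary.AllPairs using ([]; _∷_)
open import Data.List.Relation.Unary.Unique.Propositional using (Unique)
import Data.List.Relation.Unary.Unique.Propositional.Properties as UniqueP
import Data.List.Relation.Binary.Permutation.Setoid.Properties as PermP
import Data.List.Membership.Propositional as LM
import Data.List.Membership.Propositional.Properties as LMP
import Data.List.Membership.DecPropositional as LMD
open import Relation.Nullary using (¬_; Dec; yes; no; does)
open import Relation.Nullary.Decidable using (_×-dec_; _⊎-dec_; ¬?)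
open import Relation.Binary.Definitions using (DecidableEquality)
open import Relation.Binary.PropositionalEquality
  using (_≡_; _≢_; refl; sym; trans; cong; cong₂; subst; subst₂; setoid; module ≡-Reasoning)

module WalkOps {A : Set} {R : A → A → Set} where

  walkStart : ∀ {P a b} → Walk R P a b → P a
  walkStart (here p)     = p
  walkStart (step p _ _) = p

  walkEnd : ∀ {P a b} → Walk R P a b → P b
  walkEnd (here p)     = p
  walkEnd (step _ _ w) = walkEnd w

  infixr 5 _++ʷ_
  _++ʷ_ : ∀ {P a b c} → Walk R P a b → Walk R P b c → Walk R P a c
  here _     ++ʷ w₂ = w₂
  step p r w ++ʷ w₂ = step p r (w ++ʷ w₂)

  weaken : ∀ {P Q : A → Set} {a b} → (∀ {x} → P x → Q x) → Walk R P a b → Walk R Q a b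
  weaken f (here p)     = here (f p)
  weaken f (step p r w) = step (f p) r (weaken f w)

  reverse : ∀ {P a b} → (∀ {x y} → R x y → R y x) → Walk R P a b → Walk R P b a
  reverse sym-R (here p)     = here p
  reverse sym-R (step p r w) = reverse sym-R w ++ʷ step (walkStart w) (sym-R r) (here p)

  lastVisit : ∀ {Q : A → Set} → (∀ a → Dec (Q a)) → ∀ {a b} → Walk R (λ _ → ⊤) a b → ¬ Q b →
    Walk R (λ l → ¬ Q l) a b ⊎ (Σ A λ w → Σ A λ z → R w z × Q w × Walk R (λ l → ¬ Q l) z b)
  lastVisit Q? (here _) ¬Qb = inj₁ (here ¬Qb)
  lastVisit Q? (step {u = a} {w = a′} _ r rest) ¬Qb with lastVisit Q? rest ¬Qb
  ... | inj₂ found = inj₂ found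
  ... | inj₁ avoiding with Q? a
  ...   | yes Qa = inj₂ (a , a′ , r , Qa , avoiding)
  ...   | no ¬Qa = inj₁ (step ¬Qa r avoiding)

  entry : ∀ {P} {Q : A → Set} → (∀ a → Dec (Q a)) → ∀ {a b} → Walk R P a b → ¬ Q a → Q b →
    Σ A λ y → Σ A λ z → R y z × ¬ Q y × Q z
  entry Q? (here _) ¬Qa Qb = ⊥-elim (¬Qa Qb)
  entry Q? (step {u = a} {w = a′} _ r rest) ¬Qa Qb with Q? a′
  ... | yes Qa′ = a , a′ , r , ¬Qa , Qa′
  ... | no ¬Qa′ = entry Q? rest ¬Qa′ Qb

  vertices : ∀ {P a b} → Walk R P a b → List A
  vertices (here {u} _)     = u ∷ []
  vertices (step {u} _ _ w) = u ∷ vertices w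

  vertices-inside : ∀ {P a b} (w : Walk R P a b) → All P (vertices w)
  vertices-inside (here p)     = p ∷ []
  vertices-inside (step p _ w) = p ∷ vertices-inside w

mapWalk : ∀ {X Y : Set} {R : X → X → Set} {S : Y → Y → Set} {P : X → Set} {Q : Y → Set}
  (f : X → Y) → (∀ {a b} → R a b → S (f a) (f b)) → (∀ {a} → P a → Q (f a)) →
  ∀ {a b} → Walk R P a b → Walk S Q (f a) (f b)
mapWalk f fR fP (here p)     = here (fP p)
mapWalk f fR fP (step p r w) = step (fP p) (fR r) (mapWalk f fR fP w)

module Paths {A : Set} {R : A → A → Set} (_≟ᴬ_ : DecidableEquality A) where
  open WalkOps {A} {R}
  open LMD _≟ᴬ_ using () renaming (_∈?_ to _∈ˡ?_)

  chain-snoc : ∀ {P a b c} (w : Walk R P a b) → R b c → Chain R (vertices w ++ [ c ])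
  chain-snoc (here _)                r  = r , tt
  chain-snoc (step _ r (here _))     r′ = r , r′ , tt
  chain-snoc (step _ r (step p r₁ w)) r′ = r , chain-snoc (step p r₁ w) r′

  suffixFrom : ∀ {P a a′ b} (w : Walk R P a′ b) → a LM.∈ vertices w → Walk R P a b
  suffixFrom (here p)       (here refl) = here p
  suffixFrom (step p r w)   (here refl) = step p r w
  suffixFrom (step _ _ w)   (there i)   = suffixFrom w i

  suffixFrom-unique : ∀ {P a a′ b} (w : Walk R P a′ b) (i : a LM.∈ vertices w) →
    Unique (vertices w) → Unique (vertices (suffixFrom w i))
  suffixFrom-unique (here _)     (here refl) u       = u
  suffixFrom-unique (step _ _ _) (here refl) u       = u
  suffixFrom-unique (step _ _ w) (there i)   (_ ∷ u) = suffixFrom-unique w i u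

  toPath : ∀ {P a b} → Walk R P a b → Σ (Walk R P a b) (λ w → Unique (vertices w))
  toPath (here p) = here p , ([] ∷ [])
  toPath (step {a} p r w) with toPath w
  ... | w′ , u′ with a ∈ˡ? vertices w′
  ... | yes i = suffixFrom w′ i , suffixFrom-unique w′ i u′
  ... | no a∉ = step p r w′ , (AllP.¬Any⇒All¬ (vertices w′) a∉ ∷ u′)

  cycleThrough : ∀ {w₀ y z} → Walk R (λ q → q ≢ w₀) y z → y ≢ z → R w₀ y → R z w₀ → HasCycle R
  cycleThrough {w₀} walk y≢z r₁ r₂ with toPath walk
  ... | here _ , _ = ⊥-elim (y≢z refl)
  ... | path@(step {u = y} p r w) , unique =
    w₀ , vertices path , long w , (All.map (_∘ sym) (vertices-inside path) ∷ unique) ,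
    (r₁ , chain-snoc path r₂)
    where
      long : ∀ {P a b} (w : Walk R P a b) → 2 ≤ length (y ∷ vertices w)
      long (here _)     = s≤s (s≤s z≤n)
      long (step _ _ _) = s≤s (s≤s z≤n)

module TreeSides {m} {T : Fin m → Fin m → Set} (tree : IsTree T) where
  open IsTree tree
  open WalkOps {Fin m} {T}
  open Paths {Fin m} {T} _≟_

  Side : Fin m → Fin m → Fin m → Set
  Side w z q = Walk T (λ l → l ≢ w) z q

  private
    T-sym : ∀ {x y} → T x y → T y x
    T-sym {x} {y} = symmetric x y

  -- two different neighbours of w do not share a side: this would close a cycle
  side-unique : ∀ {w y z q} → T w y → T w z → y ≢ z → Side w y q → Side w z q → ⊥
  side-unique w~y w~z y≢z y-side z-side =
    acyclic (cycleThrough (y-side ++ʷ reverse T-sym z-side) y≢z w~y (T-sym w~z))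

  side? : ∀ {w z} → T w z → (q : Fin m) → Dec (Side w z q)
  side? {w} {z} w~z q with q ≟ w
  ... | yes refl = no (λ s → walkEnd s refl)
  ... | no q≢w with lastVisit (_≟ w) (connected w q) q≢w
  ...   | inj₁ avoiding = ⊥-elim (walkStart avoiding refl)
  ...   | inj₂ (_ , y , w~y , refl , y-side) with y ≟ z
  ...     | yes refl = yes y-side
  ...     | no y≢z   = no (side-unique w~y w~z y≢z y-side)

  crossesEdge : ∀ {w z p q} {Q : Fin m → Set} → T w z →
    (∀ a b → Q a → Q b → Walk T Q a b) →
    Q p → Side w z p → Q q → ¬ Side w z q → Q w × Q z
  crossesEdge {w} {z} {p} {q} {Q} w~z Q-connected Qp p-side Qq q-not-side =
    go (Q-connected p q Qp Qq) p-side
    where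
      go : ∀ {a} → Walk T Q a q → Side w z a → Q w × Q z
      go (here _) a-side = ⊥-elim (q-not-side a-side)
      go (step {u = a} {w = a′} Qa r rest) a-side with a′ ≟ w
      ... | no a′≢w = go rest (a-side ++ʷ step (walkEnd a-side) r (here a′≢w))
      ... | yes refl with a ≟ z
      ...   | yes refl = walkStart rest , Qa
      ...   | no a≢z   = ⊥-elim (side-unique (T-sym r) w~z a≢z (here (walkEnd a-side)) a-side)

module CycleLists {A : Set} {R : A → A → Set} where

  chain-split : ∀ (xs : List A) {y ys} → Chain R (xs ++ y ∷ ys) →
    Chain R (xs ++ [ y ]) × Chain R (y ∷ ys)
  chain-split []            c       = tt , c
  chain-split (x ∷ [])      (r , c) = (r , tt) , c
  chain-split (x ∷ x′ ∷ xs) (r , c) with chain-split (x′ ∷ xs) c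
  ... | c₁ , c₂ = (r , c₁) , c₂

  chain-join : ∀ (xs : List A) {y ys} → Chain R (xs ++ [ y ]) → Chain R (y ∷ ys) →
    Chain R (xs ++ y ∷ ys)
  chain-join []            c₁       c₂ = c₂
  chain-join (x ∷ [])      (r , _)  c₂ = r , c₂
  chain-join (x ∷ x′ ∷ xs) (r , c₁) c₂ = r , chain-join (x′ ∷ xs) c₁ c₂

  chain-init : ∀ (ys : List A) {z} → Chain R (ys ++ [ z ]) → Chain R ys
  chain-init []            c       = tt
  chain-init (y ∷ [])      c       = tt
  chain-init (y ∷ y′ ∷ ys) (r , c) = r , chain-init (y′ ∷ ys) c

  rotateCycle : ∀ x xs y → 2 ≤ length xs → Unique (x ∷ xs) → Chain R (x ∷ xs ++ [ x ]) →
    y LM.∈ (x ∷ xs) →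
    Σ (List A) λ ys → 2 ≤ length ys × Unique (y ∷ ys) × Chain R (y ∷ ys ++ [ y ])
  rotateCycle x xs y long u c (here refl) = xs , long , u , c
  rotateCycle x xs y long u c (there i) with LMP.∈-∃++ i
  ... | as , bs , refl = bs ++ x ∷ as , long′ , unique′ , chain′
    where
      split : x ∷ (as ++ y ∷ bs) ++ [ x ] ≡ (x ∷ as) ++ y ∷ (bs ++ [ x ])
      split = cong (x ∷_) (++-assoc as (y ∷ bs) [ x ])
      joined : y ∷ (bs ++ x ∷ as) ++ [ y ] ≡ (y ∷ bs) ++ x ∷ (as ++ [ y ])
      joined = cong (y ∷_) (++-assoc bs (x ∷ as) [ y ])
      halves = chain-split (x ∷ as) (subst (Chain R) split c)
      chain′ : Chain R (y ∷ (bs ++ x ∷ as) ++ [ y ])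
      chain′ = subst (Chain R) (sym joined) (chain-join (y ∷ bs) (proj₂ halves) (proj₁ halves))
      unique′ : Unique (y ∷ bs ++ x ∷ as)
      unique′ = PermP.Unique-resp-↭ (setoid A) (PermP.++-comm (setoid A) (x ∷ as) (y ∷ bs)) u
      same-length : length (bs ++ x ∷ as) ≡ length (as ++ y ∷ bs)
      same-length = begin
        length (bs ++ x ∷ as)        ≡⟨ length-++ bs ⟩
        length bs + suc (length as)  ≡⟨ +-suc (length bs) (length as) ⟩
        suc (length bs + length as)  ≡⟨ cong suc (+-comm (length bs) (length as)) ⟩
        suc (length as + length bs)  ≡⟨ sym (+-suc (length as) (length bs)) ⟩
        length as + suc (length bs)  ≡⟨ sym (length-++ as) ⟩
        length (as ++ y ∷ bs)        ∎
        where open ≡-Reasoning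
      long′ : 2 ≤ length (bs ++ x ∷ as)
      long′ = ≤-trans long (≤-reflexive (sym same-length))

chain-map : ∀ {A B : Set} {R : A → A → Set} {S : B → B → Set} (f : A → B) →
  (∀ {a b} → R a b → S (f a) (f b)) → ∀ l → Chain R l → Chain S (map f l)
chain-map f fR []           c       = tt
chain-map f fR (x ∷ [])     c       = tt
chain-map f fR (x ∷ x′ ∷ l) (r , c) = fR r , chain-map f fR (x′ ∷ l) c

cycle-map : ∀ {A B : Set} {R : A → A → Set} {S : B → B → Set} (f : A → B) →
  (∀ {a b} → f a ≡ f b → a ≡ b) → (∀ {a b} → R a b → S (f a) (f b)) → HasCycle R → HasCycle S
cycle-map f f-inj fR (x , xs , long , u , c) =
  f x , map f xs , subst (2 ≤_) (sym (length-map f xs)) long , UniqueP.map⁺ f-inj u ,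
  subst (λ l → Chain _ (f x ∷ l)) (map-++ f xs [ x ]) (chain-map f fR (x ∷ xs ++ [ x ]) c)

chain-comap : ∀ {A B : Set} {R : A → A → Set} {S : B → B → Set} (f : A → B) →
  (∀ {a b} → S (f a) (f b) → R a b) → ∀ l → Chain S (map f l) → Chain R l
chain-comap f fS []           c       = tt
chain-comap f fS (x ∷ [])     c       = tt
chain-comap f fS (x ∷ x′ ∷ l) (r , c) = fS r , chain-comap f fS (x′ ∷ l) c

cycle-comap : ∀ {A B : Set} {R : A → A → Set} {S : B → B → Set} (f : A → B) →
  (∀ {a b} → S (f a) (f b) → R a b) → ∀ x xs → 2 ≤ length (map f xs) →
  Unique (f x ∷ map f xs) → Chain S (f x ∷ map f xs ++ [ f x ]) → HasCycle R
cycle-comap f fS x xs long u c =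
  x , xs , subst (2 ≤_) (length-map f xs) long , UniqueP.map⁻ u ,
  chain-comap f fS (x ∷ xs ++ [ x ]) (subst (λ l → Chain _ (f x ∷ l)) (sym (map-++ f xs [ x ])) c)

module Glue {m₁ m₂} {T₁ : Fin m₁ → Fin m₁ → Set} {T₂ : Fin m₂ → Fin m₂ → Set}
            (tree₁ : IsTree T₁) (tree₂ : IsTree T₂) (p : Fin m₁) (q : Fin m₂) where

  private
    module I₁ = IsTree tree₁
    module I₂ = IsTree tree₂

  Node : Set
  Node = Fin m₁ ⊎ Fin m₂

  infix 4 _~_
  _~_ : Node → Node → Set
  inj₁ a ~ inj₁ b = T₁ a b
  inj₂ a ~ inj₂ b = T₂ a b
  inj₁ a ~ inj₂ b = a ≡ p × b ≡ q
  inj₂ b ~ inj₁ a = a ≡ p × b ≡ q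

  ~-sym : ∀ {a b} → a ~ b → b ~ a
  ~-sym {inj₁ a} {inj₁ b} r = I₁.symmetric a b r
  ~-sym {inj₂ a} {inj₂ b} r = I₂.symmetric a b r
  ~-sym {inj₁ _} {inj₂ _} r = r
  ~-sym {inj₂ _} {inj₁ _} r = r

  ~-irrefl : ∀ a → ¬ a ~ a
  ~-irrefl (inj₁ a) = I₁.irreflex a
  ~-irrefl (inj₂ a) = I₂.irreflex a

  Both : (Fin m₁ → Set) → (Fin m₂ → Set) → Node → Set
  Both Q₁ Q₂ (inj₁ a) = Q₁ a
  Both Q₁ Q₂ (inj₂ b) = Q₂ b

  open WalkOps {Node} {_~_}

  liftˡ : ∀ {Q₁ Q₂ a b} → Walk T₁ Q₁ a b → Walk _~_ (Both Q₁ Q₂) (inj₁ a) (inj₁ b)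
  liftˡ = mapWalk inj₁ (λ r → r) (λ x → x)

  liftʳ : ∀ {Q₁ Q₂ a b} → Walk T₂ Q₂ a b → Walk _~_ (Both Q₁ Q₂) (inj₂ a) (inj₂ b)
  liftʳ = mapWalk inj₂ (λ r → r) (λ x → x)

  crossˡʳ : ∀ {Q₁ Q₂ a b} → Walk T₁ Q₁ a p → Walk T₂ Q₂ q b → Walk _~_ (Both Q₁ Q₂) (inj₁ a) (inj₂ b)
  crossˡʳ w₁ w₂ = liftˡ w₁ ++ʷ step (WalkOps.walkEnd w₁) (refl , refl) (liftʳ w₂)

  crossʳˡ : ∀ {Q₁ Q₂ a b} → Walk T₂ Q₂ a q → Walk T₁ Q₁ p b → Walk _~_ (Both Q₁ Q₂) (inj₂ a) (inj₁ b)
  crossʳˡ w₂ w₁ = liftʳ w₂ ++ʷ step (WalkOps.walkEnd w₂) (refl , refl) (liftˡ w₁)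

  ~-connected : ∀ a b → Walk _~_ (λ _ → ⊤) a b
  ~-connected (inj₁ a) (inj₁ b) = mapWalk inj₁ (λ r → r) (λ x → x) (I₁.connected a b)
  ~-connected (inj₂ a) (inj₂ b) = mapWalk inj₂ (λ r → r) (λ x → x) (I₂.connected a b)
  ~-connected (inj₁ a) (inj₂ b) =
    weaken _ (crossˡʳ {Q₁ = λ _ → ⊤} {Q₂ = λ _ → ⊤} (I₁.connected a p) (I₂.connected q b))
  ~-connected (inj₂ a) (inj₁ b) =
    weaken _ (crossʳˡ {Q₁ = λ _ → ⊤} {Q₂ = λ _ → ⊤} (I₂.connected a q) (I₁.connected p b))

  -- A chain avoiding inj₁ p never uses the new edge, so it stays
  -- in one half, where cycles are excluded.  A cycle through inj₁ p, rotated
  -- to start there, would have to leave and re-enter via inj₂ q, visiting it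
  -- twice.
  Left Right : Node → Set
  Left  = Both (λ _ → ⊤) (λ _ → ⊥)
  Right = Both (λ _ → ⊥) (λ _ → ⊤)

  oneHalf : ∀ zs → Chain _~_ zs → All (λ e → e ≢ inj₁ p) zs → All Left zs ⊎ All Right zs
  oneHalf [] _ _ = inj₁ []
  oneHalf (inj₁ a ∷ []) _ _ = inj₁ (tt ∷ [])
  oneHalf (inj₂ a ∷ []) _ _ = inj₂ (tt ∷ [])
  oneHalf (z ∷ z′ ∷ zs) (r , c) (_ ∷ avoid) with oneHalf (z′ ∷ zs) c avoid
  oneHalf (inj₁ a ∷ inj₁ b ∷ zs) _ _ | inj₁ all = inj₁ (tt ∷ all)
  oneHalf (inj₂ a ∷ inj₂ b ∷ zs) _ _ | inj₂ all = inj₂ (tt ∷ all)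
  oneHalf (inj₁ a ∷ inj₁ b ∷ zs) _ _ | inj₂ (() ∷ _)
  oneHalf (inj₂ a ∷ inj₂ b ∷ zs) _ _ | inj₁ (() ∷ _)
  oneHalf (inj₁ a ∷ inj₂ b ∷ zs) ((refl , _) , _) (a≢p ∷ _) | _ = ⊥-elim (a≢p refl)
  oneHalf (inj₂ a ∷ inj₁ b ∷ zs) ((refl , _) , _) (_ ∷ b≢p ∷ _) | _ = ⊥-elim (b≢p refl)

  fromLeft : ∀ zs → All Left zs → Σ (List (Fin m₁)) λ l → map inj₁ l ≡ zs
  fromLeft [] _ = [] , refl
  fromLeft (inj₁ a ∷ zs) (_ ∷ all) with fromLeft zs all
  ... | l , refl = a ∷ l , refl

  fromRight : ∀ zs → All Right zs → Σ (List (Fin m₂)) λ l → map inj₂ l ≡ zs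
  fromRight [] _ = [] , refl
  fromRight (inj₂ a ∷ zs) (_ ∷ all) with fromRight zs all
  ... | l , refl = a ∷ l , refl

  noCycleˡ : ∀ x xs → All Left (x ∷ xs) → 2 ≤ length xs → Unique (x ∷ xs) →
    Chain _~_ (x ∷ xs ++ [ x ]) → ⊥
  noCycleˡ (inj₁ x) xs (_ ∷ all) long u c with fromLeft xs all
  ... | l , refl = I₁.acyclic (cycle-comap {R = T₁} {S = _~_} inj₁ (λ r → r) x l long u c)

  noCycleʳ : ∀ x xs → All Right (x ∷ xs) → 2 ≤ length xs → Unique (x ∷ xs) →
    Chain _~_ (x ∷ xs ++ [ x ]) → ⊥
  noCycleʳ (inj₂ x) xs (_ ∷ all) long u c with fromRight xs all
  ... | l , refl = I₂.acyclic (cycle-comap {R = T₂} {S = _~_} inj₂ (λ r → r) x l long u c)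

  penultimate : ∀ a rest {z} → 1 ≤ length rest → Chain _~_ ((a ∷ rest) ++ [ z ]) →
    Σ Node λ y → y LM.∈ rest × y ~ z
  penultimate a (b ∷ [])      _ (_ , r , _) = b , here refl , r
  penultimate a (b ∷ b′ ∷ bs) _ (_ , c) with penultimate b (b′ ∷ bs) (s≤s z≤n) c
  ... | y , i , r = y , there i , r

  _≟ᴺ_ : DecidableEquality Node
  _≟ᴺ_ = SumP.≡-dec _≟_ _≟_

  rightLoop : ∀ y → Right y → inj₁ p ~ y → ∀ rest → All Right rest → Unique (y ∷ rest) →
    Chain _~_ (y ∷ rest ++ [ inj₁ p ]) → 2 ≤ length (y ∷ rest) → ⊥
  rightLoop (inj₂ b) _ (_ , refl) rest rights (q∉rest ∷ _) c (s≤s nonempty)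
    with penultimate (inj₂ q) rest nonempty c
  ... | inj₁ a , i , _        = All.lookup rights i
  ... | inj₂ b′ , i , (_ , refl) = All.lookup q∉rest i refl

  ~-acyclic : ¬ HasCycle _~_
  ~-acyclic (x , xs , long , u , c) with LMD._∈?_ _≟ᴺ_ (inj₁ p) (x ∷ xs)
  ... | no p∉ with oneHalf (x ∷ xs ++ [ x ]) c avoid
    where
      avoid : All (λ e → e ≢ inj₁ p) (x ∷ xs ++ [ x ])
      avoid with All.map (_∘ sym) (AllP.¬Any⇒All¬ (x ∷ xs) p∉)
      ... | a ∷ as = a ∷ AllP.++⁺ as (a ∷ [])
  ...   | inj₁ (a ∷ all) = noCycleˡ x xs (a ∷ AllP.++⁻ˡ xs all) long u c
  ...   | inj₂ (a ∷ all) = noCycleʳ x xs (a ∷ AllP.++⁻ˡ xs all) long u c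
  ~-acyclic (x , xs , long , u , c) | yes p∈
    with CycleLists.rotateCycle x xs (inj₁ p) long u c p∈
  ... | (y ∷ rest) , long′ , (p∉ ∷ u′) , (r , c′)
    with oneHalf (y ∷ rest) (CycleLists.chain-init (y ∷ rest) c′) (All.map (_∘ sym) p∉)
  ...   | inj₁ lefts          = noCycleˡ (inj₁ p) (y ∷ rest) (tt ∷ lefts) long′ (p∉ ∷ u′) (r , c′)
  ...   | inj₂ (ry ∷ rights) = rightLoop y ry r rest rights u′ c′ long′

  Glued : Fin (m₁ + m₂) → Fin (m₁ + m₂) → Set
  Glued i j = splitAt m₁ i ~ splitAt m₁ j

  toGlued : ∀ {Q : Node → Set} {i j} → Walk _~_ Q (splitAt m₁ i) (splitAt m₁ j) →
    Walk Glued (Q ∘ splitAt m₁) i j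
  toGlued {Q} {i} {j} w =
    subst₂ (Walk Glued (Q ∘ splitAt m₁)) (join-splitAt m₁ m₂ i) (join-splitAt m₁ m₂ j)
      (mapWalk (join m₁ m₂)
        (λ {a} {b} r → subst₂ _~_ (sym (splitAt-join m₁ m₂ a)) (sym (splitAt-join m₁ m₂ b)) r)
        (λ {a} x → subst Q (sym (splitAt-join m₁ m₂ a)) x) w)

  splitAt-injective : ∀ {i j : Fin (m₁ + m₂)} → splitAt m₁ i ≡ splitAt m₁ j → i ≡ j
  splitAt-injective {i} {j} e =
    trans (sym (join-splitAt m₁ m₂ i)) (trans (cong (join m₁ m₂) e) (join-splitAt m₁ m₂ j))

  glued-tree : IsTree Glued
  glued-tree = record
    { nonempty  = ≤-trans I₁.nonempty (m≤m+n m₁ m₂)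
    ; symmetric = λ i j → ~-sym {splitAt m₁ i} {splitAt m₁ j}
    ; irreflex  = λ i → ~-irrefl (splitAt m₁ i)
    ; connected = λ i j → toGlued (~-connected (splitAt m₁ i) (splitAt m₁ j))
    ; acyclic   = λ cyc → ~-acyclic (cycle-map (splitAt m₁) splitAt-injective (λ r → r) cyc)
    }

  bridge : Glued (join m₁ m₂ (inj₁ p)) (join m₁ m₂ (inj₂ q))
  bridge = subst₂ _~_ (sym (splitAt-join m₁ m₂ (inj₁ p))) (sym (splitAt-join m₁ m₂ (inj₂ q))) (refl , refl)

  module Decomposition {n} (G : Graph n) (bag₁ : Fin m₁ → Subset n) (bag₂ : Fin m₂ → Subset n)
    (subtree₁ : ∀ v a b → v ∈ bag₁ a → v ∈ bag₁ b → Walk T₁ (λ l → v ∈ bag₁ l) a b)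
    (subtree₂ : ∀ v a b → v ∈ bag₂ a → v ∈ bag₂ b → Walk T₂ (λ l → v ∈ bag₂ l) a b)
    (through : ∀ v a b → v ∈ bag₁ a → v ∈ bag₂ b → v ∈ bag₁ p × v ∈ bag₂ q)
    (covers′ : ∀ v → (∃ λ a → v ∈ bag₁ a) ⊎ (∃ λ b → v ∈ bag₂ b))
    (edgeCover′ : ∀ u v → (u , v) LM.∈ edges G →
      (∃ λ a → u ∈ bag₁ a × v ∈ bag₁ a) ⊎ (∃ λ b → u ∈ bag₂ b × v ∈ bag₂ b)) where

    bagᴺ : Node → Subset n
    bagᴺ (inj₁ a) = bag₁ a
    bagᴺ (inj₂ b) = bag₂ b

    bagᴳ : Fin (m₁ + m₂) → Subset n
    bagᴳ i = bagᴺ (splitAt m₁ i)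

    bagᴳ-join : ∀ u → bagᴳ (join m₁ m₂ u) ≡ bagᴺ u
    bagᴳ-join u = cong bagᴺ (splitAt-join m₁ m₂ u)

    private
      atJoin : ∀ {v} u → v ∈ bagᴺ u → v ∈ bagᴳ (join m₁ m₂ u)
      atJoin {v} u h = subst (v ∈_) (sym (bagᴳ-join u)) h

      inBoth : ∀ {v} {x} → Both (λ l → v ∈ bag₁ l) (λ l → v ∈ bag₂ l) x → v ∈ bagᴺ x
      inBoth {x = inj₁ _} h = h
      inBoth {x = inj₂ _} h = h

      subtreeᴺ : ∀ v a b → v ∈ bagᴺ a → v ∈ bagᴺ b → Walk _~_ (λ u → v ∈ bagᴺ u) a b
      subtreeᴺ v (inj₁ a) (inj₁ b) ha hb =
        weaken (λ {x} → inBoth {v} {x}) (liftˡ {Q₂ = λ l → v ∈ bag₂ l} (subtree₁ v a b ha hb))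
      subtreeᴺ v (inj₂ a) (inj₂ b) ha hb =
        weaken (λ {x} → inBoth {v} {x}) (liftʳ {Q₁ = λ l → v ∈ bag₁ l} (subtree₂ v a b ha hb))
      subtreeᴺ v (inj₁ a) (inj₂ b) ha hb with through v a b ha hb
      ... | hp , hq = weaken (λ {x} → inBoth {v} {x}) (crossˡʳ (subtree₁ v a p ha hp) (subtree₂ v q b hq hb))
      subtreeᴺ v (inj₂ a) (inj₁ b) ha hb with through v b a hb ha
      ... | hp , hq = weaken (λ {x} → inBoth {v} {x}) (crossʳˡ (subtree₂ v a q ha hq) (subtree₁ v p b hp hb))

      coverᴳ : ∀ v → (∃ λ a → v ∈ bag₁ a) ⊎ (∃ λ b → v ∈ bag₂ b) → ∃ λ i → v ∈ bagᴳ i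
      coverᴳ v (inj₁ (a , h)) = join m₁ m₂ (inj₁ a) , atJoin (inj₁ a) h
      coverᴳ v (inj₂ (b , h)) = join m₁ m₂ (inj₂ b) , atJoin (inj₂ b) h

      edgeCoverᴳ : ∀ u v → (∃ λ a → u ∈ bag₁ a × v ∈ bag₁ a) ⊎ (∃ λ b → u ∈ bag₂ b × v ∈ bag₂ b) →
        ∃ λ i → u ∈ bagᴳ i × v ∈ bagᴳ i
      edgeCoverᴳ u v (inj₁ (a , hu , hv)) = join m₁ m₂ (inj₁ a) , atJoin (inj₁ a) hu , atJoin (inj₁ a) hv
      edgeCoverᴳ u v (inj₂ (b , hu , hv)) = join m₁ m₂ (inj₂ b) , atJoin (inj₂ b) hu , atJoin (inj₂ b) hv

    glued : TreeDecomposition G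
    glued = record
      { m         = m₁ + m₂
      ; TAdj      = Glued
      ; isTree    = glued-tree
      ; bag       = bagᴳ
      ; covers    = λ v → coverᴳ v (covers′ v)
      ; edgeCover = λ u v e → edgeCoverᴳ u v (edgeCover′ u v e)
      ; subtree   = λ v i j hi hj → toGlued (subtreeᴺ v (splitAt m₁ i) (splitAt m₁ j) hi hj)
      }

module Comprehension {n : ℕ} {P : Fin n → Set} (P? : ∀ v → Dec (P v)) where

  ⟦_⟧ : Subset n
  ⟦_⟧ = tabulate (λ v → if does (P? v) then inside else outside)

  private
    holds⇒inside : ∀ v → P v → (if does (P? v) then inside else outside) ≡ inside
    holds⇒inside v pv with P? v
    ... | yes _  = refl
    ... | no ¬pv = ⊥-elim (¬pv pv)

    inside⇒holds : ∀ v → (if does (P? v) then inside else outside) ≡ inside → P v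
    inside⇒holds v e with P? v
    ... | yes pv = pv
    ... | no _ with e
    ...   | ()

  ∈⟦⟧⁺ : ∀ {v} → P v → v ∈ ⟦_⟧
  ∈⟦⟧⁺ {v} pv = lookup⇒[]= v _ (trans (lookup∘tabulate _ v) (holds⇒inside v pv))

  ∈⟦⟧⁻ : ∀ {v} → v ∈ ⟦_⟧ → P v
  ∈⟦⟧⁻ {v} h = inside⇒holds v (trans (sym (lookup∘tabulate _ v)) ([]=⇒lookup h))

open Comprehension using (⟦_⟧; ∈⟦⟧⁺; ∈⟦⟧⁻)

_≟ˢ_ : ∀ {n} → DecidableEquality (Subset n)
_≟ˢ_ = VecP.≡-dec BoolP._≟_

∣p∣≤1+∣q∣ : ∀ {n} (p q : Subset n) (v : Fin n) → (∀ {u} → u ∈ p → u ∈ q ⊎ u ≡ v) → ∣ p ∣ ≤ suc ∣ q ∣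
∣p∣≤1+∣q∣ {suc n} (a ∷ p) (b ∷ q) zero p⊆q+v = ≤-trans (head-counts a p) (s≤s (≤-trans tail-⊆ (∣p∣≤∣x∷p∣ b q)))
  where
    tail-⊆ : ∣ p ∣ ≤ ∣ q ∣
    tail-⊆ = p⊆q⇒∣p∣≤∣q∣ (λ hu → drop (p⊆q+v (Vec.there hu)))
      where
        drop : ∀ {u} → suc u ∈ b ∷ q ⊎ suc u ≡ zero → u ∈ q
        drop (inj₁ (Vec.there h)) = h
    head-counts : ∀ a (p : Subset n) → ∣ a ∷ p ∣ ≤ suc ∣ p ∣
    head-counts true  p = ≤-refl
    head-counts false p = n≤1+n _
∣p∣≤1+∣q∣ {suc n} (a ∷ p) (b ∷ q) (suc v) p⊆q+v = go a b head-⊆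
  where
    tail-bound : ∣ p ∣ ≤ suc ∣ q ∣
    tail-bound = ∣p∣≤1+∣q∣ p q v (λ hu → drop (p⊆q+v (Vec.there hu)))
      where
        drop : ∀ {u} → suc u ∈ b ∷ q ⊎ suc u ≡ suc v → u ∈ q ⊎ u ≡ v
        drop (inj₁ (Vec.there h)) = inj₁ h
        drop (inj₂ refl)          = inj₂ refl
    head-⊆ : a ≡ inside → b ≡ inside
    head-⊆ refl with p⊆q+v Vec.here
    ... | inj₁ Vec.here = refl
    go : ∀ a b → (a ≡ inside → b ≡ inside) → ∣ a ∷ p ∣ ≤ suc ∣ b ∷ q ∣
    go true  true  _ = s≤s tail-bound
    go true  false f with f refl
    ... | ()
    go false true  _ = ≤-trans tail-bound (n≤1+n _)
    go false false _ = tail-bound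

⊆-or-witness : ∀ {n} (p q : Subset n) → p ⊆ q ⊎ ∃ λ v → v ∈ p × v ∉ q
⊆-or-witness p q with any? (λ v → (v ∈? p) ×-dec ¬? (v ∈? q))
... | yes witness = inj₂ witness
... | no none = inj₁ p⊆q
  where
    p⊆q : p ⊆ q
    p⊆q {v} v∈p with v ∈? q
    ... | yes v∈q = v∈q
    ... | no v∉q  = ⊥-elim (none (v , v∈p , v∉q))

⊊⇒∣p∣<∣q∣ : ∀ {n} {p q : Subset n} → p ⊆ q → q ≢ p → ∣ p ∣ < ∣ q ∣
⊊⇒∣p∣<∣q∣ {p = p} {q} p⊆q q≢p with ⊆-or-witness q p
... | inj₁ q⊆p = ⊥-elim (q≢p (⊆-antisym q⊆p p⊆q))
... | inj₂ (v , v∈q , v∉p) = p⊂q⇒∣p∣<∣q∣ (p⊆q , v , v∈q , v∉p)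

module _ {n : ℕ} (G : Graph n) where

  Adj-sym : ∀ {u v} → Adj G u v → Adj G v u
  Adj-sym (inj₁ e) = inj₂ e
  Adj-sym (inj₂ e) = inj₁ e

  Adj? : ∀ u v → Dec (Adj G u v)
  Adj? u v = LMD._∈?_ edge-≟ (u , v) (edges G) ⊎-dec LMD._∈?_ edge-≟ (v , u) (edges G)
    where edge-≟ = ProdP.≡-dec _≟_ _≟_

  Adj-irrefl : ∀ {u} → ¬ Adj G u u
  Adj-irrefl (inj₁ e) = All.lookup (loopless G) e refl
  Adj-irrefl (inj₂ e) = All.lookup (loopless G) e refl

  edgeInBag : (D : TreeDecomposition G) → ∀ {u v} → Adj G u v → ∃ λ i → u ∈ bag D i × v ∈ bag D i
  edgeInBag D {u} {v} (inj₁ e) = edgeCover D u v e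
  edgeInBag D {u} {v} (inj₂ e) with edgeCover D v u e
  ... | i , hv , hu = i , hu , hv

module Reachable {n : ℕ} (G : Graph n) (P : Subset n) (s : Fin n) (s∈P : s ∈ P) where
  open WalkOps {Fin n} {Adj G}

  private
    Frontier : Subset n → Fin n → Set
    Frontier R v = v ∈ P × ∃ λ u → u ∈ R × Adj G u v

    frontier? : ∀ R v → Dec (Frontier R v)
    frontier? R v = (v ∈? P) ×-dec any? (λ u → (u ∈? R) ×-dec Adj? G u v)

    expand : Subset n → Subset n
    expand R = R ∪ ⟦ frontier? R ⟧

    expand-mono : ∀ {A B} → A ⊆ B → expand A ⊆ expand B
    expand-mono {A} {B} A⊆B h with x∈p∪q⁻ A _ h
    ... | inj₁ hA = x∈p∪q⁺ (inj₁ (A⊆B hA))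
    ... | inj₂ hF with ∈⟦⟧⁻ (frontier? A) hF
    ...   | vP , u , uA , adj = x∈p∪q⁺ (inj₂ (∈⟦⟧⁺ (frontier? B) (vP , u , A⊆B uA , adj)))

    iterate : ℕ → Subset n
    iterate zero    = ⁅ s ⁆
    iterate (suc k) = expand (iterate k)

    iterate-sound : ∀ k {v} → v ∈ iterate k → Walk (Adj G) (_∈ P) s v
    iterate-sound zero h with x∈⁅y⁆⇒x≡y s h
    ... | refl = here s∈P
    iterate-sound (suc k) h with x∈p∪q⁻ (iterate k) _ h
    ... | inj₁ old = iterate-sound k old
    ... | inj₂ new with ∈⟦⟧⁻ (frontier? _) new
    ...   | vP , u , uR , adj = iterate-sound k uR ++ʷ step (walkEnd (iterate-sound k uR)) adj (here vP)

    Stable : Subset n → Set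
    Stable A = expand A ⊆ A

    -- each non-stable round adds a vertex, so after n + 1 rounds it is stable
    stable-or-large : ∀ k → Stable (iterate k) ⊎ k ≤ ∣ iterate k ∣
    stable-or-large zero = inj₂ z≤n
    stable-or-large (suc k) with stable-or-large k
    ... | inj₁ st = inj₁ (expand-mono st)
    ... | inj₂ large with ⊆-or-witness (expand (iterate k)) (iterate k)
    ...   | inj₁ st = inj₁ (expand-mono st)
    ...   | inj₂ (v , v∈ , v∉) = inj₂ (<-≤-trans (s≤s large) (p⊂q⇒∣p∣<∣q∣ (p⊆p∪q _ , v , v∈ , v∉)))

  reach : Subset n
  reach = iterate (suc n)

  private
    reach-stable : Stable reach
    reach-stable with stable-or-large (suc n)
    ... | inj₁ st    = st
    ... | inj₂ large = ⊥-elim (≤⇒≯ (∣p∣≤n reach) large)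

  reach-sound : ∀ {v} → v ∈ reach → Walk (Adj G) (_∈ P) s v
  reach-sound = iterate-sound (suc n)

  reach-source : s ∈ reach
  reach-source = contains-s (suc n)
    where
      contains-s : ∀ k → s ∈ iterate k
      contains-s zero    = x∈⁅x⁆ s
      contains-s (suc k) = p⊆p∪q _ (contains-s k)

  reach-closed : ∀ {u v} → u ∈ reach → Adj G u v → v ∈ P → v ∈ reach
  reach-closed u∈ adj vP = reach-stable (x∈p∪q⁺ (inj₂ (∈⟦⟧⁺ (frontier? _) (vP , _ , u∈ , adj))))

  reach-walk : ∀ {u v} → u ∈ reach → Walk (Adj G) (_∈ P) u v → v ∈ reach
  reach-walk u∈ (here _)       = u∈
  reach-walk u∈ (step _ adj w) = reach-walk (reach-closed u∈ adj (walkStart w)) w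

AlwaysTogether : ∀ {n} → Graph n → ℕ → Fin n → Fin n → Set₁
AlwaysTogether G k s t =
  (D : TreeDecomposition G) → WidthAtMost D k → ∃ λ i → (s ∈ bag D i) × (t ∈ bag D i)

-- Let S ⊆ B_x avoid s and t, and let R be the set reached
-- from s in G - S.  Two copies of D, one with bags B_l ∩ (R ∪ S) and one with
-- bags B_l \ R, glued along x–x, form a tree decomposition of width ≤ k.  If
-- t ∉ R no bag of it contains both s and t; so under AlwaysTogether, G - S
-- contains an s–t walk.
module Splitting {n} (G : Graph n) (k : ℕ) (s t : Fin n) (together : AlwaysTogether G k s t)
                 (D : TreeDecomposition G) (width : WidthAtMost D k) (x : Fin (m D))
                 (S : Subset n) (S⊆B : S ⊆ bag D x) (s∉S : s ∉ S) (t∉S : t ∉ S) where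

  open Reachable G (∁ S) s (x∉p⇒x∈∁p s∉S)

  private
    near far : Subset n
    near = reach ∪ S
    far  = ∁ reach

    restrict : Subset n → Fin (m D) → Subset n
    restrict U l = bag D l ∩ U

    restrict-subtree : ∀ U v a b → v ∈ restrict U a → v ∈ restrict U b →
      Walk (TAdj D) (λ l → v ∈ restrict U l) a b
    restrict-subtree U v a b ha hb =
      WalkOps.weaken (λ h → x∈p∩q⁺ (h , proj₂ (x∈p∩q⁻ _ _ ha)))
        (subtree D v a b (proj₁ (x∈p∩q⁻ _ _ ha)) (proj₁ (x∈p∩q⁻ _ _ hb)))

    -- a vertex in both halves lies in S ⊆ B_x
    through : ∀ v a b → v ∈ restrict near a → v ∈ restrict far b →
      v ∈ restrict near x × v ∈ restrict far x
    through v a b ha hb with x∈p∩q⁻ _ _ ha | x∈p∩q⁻ _ _ hb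
    ... | _ , v-near | _ , v-far with x∈p∪q⁻ reach S v-near
    ...   | inj₁ r  = ⊥-elim (x∈∁p⇒x∉p v-far r)
    ...   | inj₂ vS = x∈p∩q⁺ (S⊆B vS , v-near) , x∈p∩q⁺ (S⊆B vS , v-far)

    cover : ∀ v → (∃ λ a → v ∈ restrict near a) ⊎ (∃ λ b → v ∈ restrict far b)
    cover v with covers D v | v ∈? reach
    ... | l , h | yes r = inj₁ (l , x∈p∩q⁺ (h , x∈p∪q⁺ (inj₁ r)))
    ... | l , h | no r  = inj₂ (l , x∈p∩q⁺ (h , x∉p⇒x∈∁p r))

    -- an edge leaving reach ends in S
    near-edge : ∀ {u v} → u ∈ reach → Adj G u v → v ∈ near
    near-edge {v = v} u∈ adj with v ∈? S
    ... | yes vS = x∈p∪q⁺ (inj₂ vS)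
    ... | no v∉S = x∈p∪q⁺ (inj₁ (reach-closed u∈ adj (x∉p⇒x∈∁p v∉S)))

    edgeCover′ : ∀ u v → (u , v) LM.∈ edges G →
      (∃ λ a → u ∈ restrict near a × v ∈ restrict near a) ⊎ (∃ λ b → u ∈ restrict far b × v ∈ restrict far b)
    edgeCover′ u v e with edgeCover D u v e
    ... | l , hu , hv with u ∈? reach | v ∈? reach
    ...   | yes u∈ | _     = inj₁ (l , x∈p∩q⁺ (hu , x∈p∪q⁺ (inj₁ u∈)) , x∈p∩q⁺ (hv , near-edge u∈ (inj₁ e)))
    ...   | no _   | yes v∈ = inj₁ (l , x∈p∩q⁺ (hu , near-edge v∈ (inj₂ e)) , x∈p∩q⁺ (hv , x∈p∪q⁺ (inj₁ v∈)))
    ...   | no u∉  | no v∉  = inj₂ (l , x∈p∩q⁺ (hu , x∉p⇒x∈∁p u∉) , x∈p∩q⁺ (hv , x∉p⇒x∈∁p v∉))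

    open Glue (isTree D) (isTree D) x x
    open Decomposition G (restrict near) (restrict far)
      (restrict-subtree near) (restrict-subtree far) through cover edgeCover′

    split-width : WidthAtMost glued k
    split-width i = bound (splitAt (m D) i)
      where
        bound : ∀ u → ∣ bagᴺ u ∣ ≤ k + 1
        bound (inj₁ a) = ≤-trans (∣p∩q∣≤∣p∣ (bag D a) near) (width a)
        bound (inj₂ b) = ≤-trans (∣p∩q∣≤∣p∣ (bag D b) far) (width b)

    apart : t ∉ reach → ∀ u → s ∈ bagᴺ u → t ∈ bagᴺ u → ⊥
    apart t∉ (inj₁ a) _ ht with x∈p∪q⁻ reach S (proj₂ (x∈p∩q⁻ _ _ ht))
    ... | inj₁ t∈  = t∉ t∈
    ... | inj₂ t∈S = t∉S t∈S
    apart t∉ (inj₂ b) hs _ = x∈∁p⇒x∉p (proj₂ (x∈p∩q⁻ _ _ hs)) reach-source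

  connectedAvoiding : Walk (Adj G) (_∈ ∁ S) s t
  connectedAvoiding with t ∈? reach
  ... | yes t∈ = reach-sound t∈
  ... | no t∉ with together glued split-width
  ...   | i , hs , ht = ⊥-elim (apart t∉ (splitAt (m D) i) hs ht)

-- A detour from s to t around B: a walk from a neighbour of s to a neighbour
-- of t inside G - B, i.e. a component of G - B adjacent to both s and t.
record Detour {n} (G : Graph n) (B : Subset n) (s t : Fin n) : Set where
  field
    c₁ c₂   : Fin n
    s~c₁    : Adj G s c₁
    excursion : Walk (Adj G) (_∉ B) c₁ c₂
    c₂~t    : Adj G c₂ t

  c₁∉B : c₁ ∉ B
  c₁∉B = WalkOps.walkStart excursion

OnlyEnds : ∀ {n} → Subset n → Fin n → Fin n → Fin n → Set
OnlyEnds B s t v = v ∈ B → v ≡ s ⊎ v ≡ t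

-- An s–t walk meeting B only in s and t, where t ∈ B and s, t are distinct
-- and non-adjacent, contains a detour: cut it after its last visit to s and
-- at its first subsequent return to B.
module _ {n} (G : Graph n) (B : Subset n) {s t : Fin n}
         (s≢t : s ≢ t) (s≁t : ¬ Adj G s t) (t∈B : t ∈ B) where
  open WalkOps {Fin n} {Adj G}

  mutual
    detour : Walk (Adj G) (OnlyEnds B s t) s t → Detour G B s t
    detour (here _) = ⊥-elim (s≢t refl)
    detour (step {w = v} _ s~v rest) with v ∈? B
    ... | no v∉B = continueDetour s~v (here v∉B) rest
    ... | yes v∈B with walkStart rest v∈B
    ...   | inj₁ refl = ⊥-elim (Adj-irrefl G s~v)
    ...   | inj₂ refl = ⊥-elim (s≁t s~v)

    -- `excursion` is the walk outside B taken so far from the neighbour c₁ of s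
    continueDetour : ∀ {c₁ v} → Adj G s c₁ → Walk (Adj G) (_∉ B) c₁ v →
      Walk (Adj G) (OnlyEnds B s t) v t → Detour G B s t
    continueDetour _ excursion (here _) = ⊥-elim (walkEnd excursion t∈B)
    continueDetour {c₁} {v} s~c₁ excursion (step {w = v′} _ v~v′ rest) with v′ ∈? B
    ... | no v′∉B = continueDetour s~c₁ (excursion ++ʷ step (walkEnd excursion) v~v′ (here v′∉B)) rest
    ... | yes v′∈B with walkStart rest v′∈B
    ...   | inj₁ refl = detour rest
    ...   | inj₂ refl = record { c₁ = c₁ ; c₂ = v ; s~c₁ = s~c₁ ; excursion = excursion ; c₂~t = v~v′ }

-- Under AlwaysTogether, every bag containing s and t admits a detour:
-- apply the splitting lemma to S = B_x \ {s, t}.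
detourAround : ∀ {n} (G : Graph n) (k : ℕ) (s t : Fin n) → AlwaysTogether G k s t → s ≢ t → ¬ Adj G s t →
  (D : TreeDecomposition G) → WidthAtMost D k → (x : Fin (m D)) → s ∈ bag D x → t ∈ bag D x →
  Detour G (bag D x) s t
detourAround {n} G k s t together s≢t s≁t D width x s∈B t∈B =
  detour G B s≢t s≁t t∈B (WalkOps.weaken onlyEnds
    (Splitting.connectedAvoiding G k s t together D width x S S⊆B s∉S t∉S))
  where
    B : Subset n
    B = bag D x
    S? : ∀ v → Dec (v ∈ B × v ≢ s × v ≢ t)
    S? v = (v ∈? B) ×-dec ¬? (v ≟ s) ×-dec ¬? (v ≟ t)
    S : Subset n
    S = ⟦ S? ⟧
    S⊆B : S ⊆ B
    S⊆B h = proj₁ (∈⟦⟧⁻ S? h)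
    s∉S : s ∉ S
    s∉S h = proj₁ (proj₂ (∈⟦⟧⁻ S? h)) refl
    t∉S : t ∉ S
    t∉S h = proj₂ (proj₂ (∈⟦⟧⁻ S? h)) refl
    onlyEnds : ∀ {v} → v ∈ ∁ S → OnlyEnds B s t v
    onlyEnds {v} v∉S v∈B with v ≟ s | v ≟ t
    ... | yes e  | _      = inj₁ e
    ... | no _   | yes e  = inj₂ e
    ... | no v≢s | no v≢t = ⊥-elim (x∈∁p⇒x∉p v∉S (∈⟦⟧⁺ S? (v∈B , v≢s , v≢t)))

argmax : ∀ {m} {P : Fin m → Set} → (∀ i → Dec (P i)) → (f : Fin m → ℕ) → ∃ P →
  Σ (Fin m) λ x → P x × (∀ y → P y → f y ≤ f x)
argmax {suc m} {P} P? f (i , Pi) with any? (P? ∘ suc)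
... | no none with i
...   | zero  = zero , Pi , λ { zero _ → ≤-refl ; (suc y) Py → ⊥-elim (none (y , Py)) }
...   | suc j = ⊥-elim (none (j , Pi))
argmax {suc m} {P} P? f (i , Pi) | yes some with argmax (P? ∘ suc) (f ∘ suc) some
... | x , Px , max with P? zero
...   | no ¬P0 = suc x , Px , λ { zero P0 → ⊥-elim (¬P0 P0) ; (suc y) Py → max y Py }
...   | yes P0 with f zero ≤? f (suc x)
...     | yes f0≤ = suc x , Px , λ { zero _ → f0≤ ; (suc y) Py → max y Py }
...     | no f0≰  = zero , P0 , λ { zero _ → ≤-refl ; (suc y) Py → ≤-trans (max y Py) (<⇒≤ (≰⇒> f0≰)) }

record SeparatorInBag {n} (G : Graph n) (k : ℕ) (s t : Fin n) (D : TreeDecomposition G) : Set where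
  field
    x         : Fin (m D)
    W         : Subset n
    W⊆B       : W ⊆ bag D x
    s∈W       : s ∈ W
    t∈W       : t ∈ W
    small     : ∣ W ∣ ≤ k
    separates : IsVertexSeparator G W

module MaximumBag {n} (G : Graph n) (k : ℕ) {s t : Fin n}
       (D : TreeDecomposition G) (width : WidthAtMost D k)
       (x : Fin (m D)) (s∈B : s ∈ bag D x) (t∈B : t ∈ bag D x)
       (maximum : ∀ y → s ∈ bag D y × t ∈ bag D y → ∣ bag D y ∣ ≤ ∣ bag D x ∣)
       (d : Detour G (bag D x) s t) where

  open Detour d

  B : Subset n
  B = bag D x

  open Reachable G (∁ B) c₁ (x∉p⇒x∈∁p c₁∉B) renaming (reach to C)

  C∩B-empty : ∀ {u} → u ∈ C → u ∉ B
  C∩B-empty h = x∈∁p⇒x∉p (WalkOps.walkEnd (reach-sound h))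

  W? : ∀ b → Dec (b ∈ B × ∃ λ c → c ∈ C × Adj G c b)
  W? b = (b ∈? B) ×-dec any? (λ c → (c ∈? C) ×-dec Adj? G c b)

  W : Subset n
  W = ⟦ W? ⟧

  W⊆B : W ⊆ B
  W⊆B h = proj₁ (∈⟦⟧⁻ W? h)

  s∈W : s ∈ W
  s∈W = ∈⟦⟧⁺ W? (s∈B , c₁ , reach-source , Adj-sym G s~c₁)

  t∈W : t ∈ W
  t∈W = ∈⟦⟧⁺ W? (t∈B , c₂ , c₂∈C , c₂~t)
    where
      c₂∈C : c₂ ∈ C
      c₂∈C = reach-walk reach-source (WalkOps.weaken x∉p⇒x∈∁p excursion)

  -- a walk in G - W starting in C never leaves C, so it cannot reach B
  separates : ∀ {b} → b ∈ B → b ∉ W → IsVertexSeparator G W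
  separates {b} b∈B b∉W connected =
    C∩B-empty (stays reach-source (connected c₁ b (λ h → c₁∉B (W⊆B h)) b∉W)) b∈B
    where
      stays : ∀ {u v} → u ∈ C → Walk (Adj G) (_∉ W) u v → v ∈ C
      stays u∈C (here _) = u∈C
      stays {u} u∈C (step {w = u′} _ adj rest) with u′ ∈? B
      ... | yes u′∈B = ⊥-elim (WalkOps.walkStart rest (∈⟦⟧⁺ W? (u′∈B , u , u∈C , adj)))
      ... | no u′∉B  = stays (reach-closed u∈C adj (x∉p⇒x∈∁p u′∉B)) rest

  -- Take a bag B_l containing the edge s c₁ (so
  -- B_l ≠ B), and on a tree walk from x to l the last node w with B_w = B,
  -- followed by z.  Every bag meeting C lies on z's side of wz, as C is
  -- connected and avoids B_w; each b ∈ B = W has a neighbour in C, so a bag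
  -- containing b lies on z's side while b ∈ B_w, forcing b ∈ B_z.  Hence
  -- B ⊊ B_z, and B_z contains s and t: this contradicts maximality.
  module _ (B⊆W : B ⊆ W) where
    open TreeSides (isTree D)

    private
      l : Fin (m D)
      l = proj₁ (edgeInBag G D s~c₁)

      c₁∈Bl : c₁ ∈ bag D l
      c₁∈Bl = proj₂ (proj₂ (edgeInBag G D s~c₁))

      boundary : Σ (Fin (m D)) λ w → Σ (Fin (m D)) λ z →
        TAdj D w z × bag D w ≡ B × bag D z ≢ B × Side w z l
      boundary with WalkOps.lastVisit (λ q → bag D q ≟ˢ B) (IsTree.connected (isTree D) x l)
                      (λ Bl≡B → c₁∉B (subst (c₁ ∈_) Bl≡B c₁∈Bl))
      ... | inj₁ avoiding = ⊥-elim (WalkOps.walkStart avoiding refl)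
      ... | inj₂ (w , z , w~z , Bw≡B , avoiding) =
        w , z , w~z , Bw≡B , WalkOps.walkStart avoiding ,
        WalkOps.weaken (λ Bq≢B q≡w → Bq≢B (trans (cong (bag D) q≡w) Bw≡B)) avoiding

    module _ {w z} (w~z : TAdj D w z) (Bw≡B : bag D w ≡ B) (l-side : Side w z l) where
      private
        AllOnSide : Fin n → Set
        AllOnSide u = ∀ q → u ∈ bag D q → Side w z q

        -- for u ∉ B_w, the subtree of bags containing u avoids w, so one
        -- bag of u on z's side puts all of them there
        oneOnSide : ∀ {u} → u ∉ B → ∀ p → u ∈ bag D p → Side w z p → AllOnSide u
        oneOnSide {u} u∉B p u∈p p-side q u∈q with side? w~z q
        ... | yes q-side = q-side
        ... | no q-other = ⊥-elim (u∉B (subst (u ∈_) Bw≡B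
              (proj₁ (crossesEdge {Q = λ i → u ∈ bag D i} w~z (subtree D u) u∈p p-side u∈q q-other))))

        C-onSide : ∀ {u} → u ∈ C → AllOnSide u
        C-onSide h = along (reach-sound h) (oneOnSide c₁∉B l c₁∈Bl l-side)
          where
            along : ∀ {u v} → Walk (Adj G) (_∈ ∁ B) u v → AllOnSide u → AllOnSide v
            along (here _) onSide = onSide
            along (step _ adj rest) onSide with edgeInBag G D adj
            ... | q , u∈q , u′∈q =
              along rest (oneOnSide (x∈∁p⇒x∉p (WalkOps.walkStart rest)) q u′∈q (onSide q u∈q))

      B⊆Bz : B ⊆ bag D z
      B⊆Bz {b} b∈B with ∈⟦⟧⁻ W? (B⊆W b∈B)
      ... | _ , c , c∈C , c~b with edgeInBag G D c~b
      ...   | q , c∈q , b∈q = proj₂ (crossesEdge {Q = λ i → b ∈ bag D i} w~z (subtree D b) b∈q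
                                 (C-onSide c∈C q c∈q) (subst (b ∈_) (sym Bw≡B) b∈B)
                                 (λ w-side → WalkOps.walkEnd w-side refl))

    whole-bag-impossible : ⊥
    whole-bag-impossible with boundary
    ... | w , z , w~z , Bw≡B , Bz≢B , l-side =
      <⇒≱ (⊊⇒∣p∣<∣q∣ B⊆Bz′ Bz≢B) (maximum z (B⊆Bz′ s∈B , B⊆Bz′ t∈B))
      where
        B⊆Bz′ : B ⊆ bag D z
        B⊆Bz′ = B⊆Bz w~z Bw≡B l-side

  separatorInBag : SeparatorInBag G k s t D
  separatorInBag with ⊆-or-witness B W
  ... | inj₁ B⊆W = ⊥-elim (whole-bag-impossible B⊆W)
  ... | inj₂ (b , b∈B , b∉W) = record
    { x = x ; W = W ; W⊆B = W⊆B ; s∈W = s∈W ; t∈W = t∈W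
    ; small = ≤-pred (≤-trans (p⊂q⇒∣p∣<∣q∣ (W⊆B , b , b∈B , b∉W)) (≤-trans (width x) (≤-reflexive (+-comm k 1))))
    ; separates = separates b∈B b∉W }

separatorInBag : ∀ {n} (G : Graph n) (k : ℕ) (s t : Fin n) → AlwaysTogether G k s t → s ≢ t → ¬ Adj G s t →
  (D : TreeDecomposition G) → WidthAtMost D k → SeparatorInBag G k s t D
separatorInBag G k s t together s≢t s≁t D width
  with argmax (λ l → (s ∈? bag D l) ×-dec (t ∈? bag D l)) (λ l → ∣ bag D l ∣) (together D width)
... | x , (s∈B , t∈B) , maximum =
  MaximumBag.separatorInBag G k D width x s∈B t∈B maximum
    (detourAround G k s t together s≢t s≁t D width x s∈B t∈B)

sumᶠ : ∀ m → (Fin m → ℕ) → ℕ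
sumᶠ zero    f = 0
sumᶠ (suc m) f = f zero + sumᶠ m (f ∘ suc)

sumᶠ-mono : ∀ m (f g : Fin m → ℕ) → (∀ l → f l ≤ g l) → sumᶠ m f ≤ sumᶠ m g
sumᶠ-mono zero    f g f≤g = z≤n
sumᶠ-mono (suc m) f g f≤g = +-mono-≤ (f≤g zero) (sumᶠ-mono m (f ∘ suc) (g ∘ suc) (f≤g ∘ suc))

sumᶠ-strict : ∀ m (f g : Fin m → ℕ) y → (∀ l → f l ≤ g l) → f y < g y → sumᶠ m f < sumᶠ m g
sumᶠ-strict (suc m) f g zero    f≤g fy<gy = +-mono-<-≤ fy<gy (sumᶠ-mono m (f ∘ suc) (g ∘ suc) (f≤g ∘ suc))
sumᶠ-strict (suc m) f g (suc y) f≤g fy<gy =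
  +-mono-≤-< (f≤g zero) (sumᶠ-strict m (f ∘ suc) (g ∘ suc) y (f≤g ∘ suc) fy<gy)

sumᶠ-bound : ∀ m (f : Fin m → ℕ) c → (∀ l → f l ≤ c) → sumᶠ m f ≤ m * c
sumᶠ-bound zero    f c f≤c = z≤n
sumᶠ-bound (suc m) f c f≤c = +-mono-≤ (f≤c zero) (sumᶠ-bound m (f ∘ suc) c (f≤c ∘ suc))

module AddToBag {n} {G : Graph n} (D : TreeDecomposition G) {y z : Fin (m D)} (y~z : TAdj D y z)
                {v : Fin n} (v∈Bz : v ∈ bag D z) where

  private
    added? : ∀ (l : Fin (m D)) u → Dec (l ≡ y × u ≡ v)
    added? l u = (l ≟ y) ×-dec (u ≟ v)

  bag′ : Fin (m D) → Subset n
  bag′ l = bag D l ∪ ⟦ added? l ⟧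

  private
    old-or-added : ∀ {u l} → u ∈ bag′ l → u ∈ bag D l ⊎ (l ≡ y × u ≡ v)
    old-or-added {u} {l} h with x∈p∪q⁻ (bag D l) _ h
    ... | inj₁ old   = inj₁ old
    ... | inj₂ added = inj₂ (∈⟦⟧⁻ (added? l) added)

  ⊆bag′ : ∀ l → bag D l ⊆ bag′ l
  ⊆bag′ l h = x∈p∪q⁺ (inj₁ h)

  v∈By′ : v ∈ bag′ y
  v∈By′ = x∈p∪q⁺ (inj₂ (∈⟦⟧⁺ (added? y) (refl , refl)))

  private
    toOld : ∀ {u i} → u ∈ bag′ i → Σ (Fin (m D)) λ i′ → u ∈ bag D i′ × Walk (TAdj D) (λ l → u ∈ bag′ l) i i′
    toOld {u} {i} h with old-or-added h
    ... | inj₁ old           = i , old , here h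
    ... | inj₂ (refl , refl) = z , v∈Bz , step h y~z (here (⊆bag′ z v∈Bz))

    subtree′ : ∀ u i j → u ∈ bag′ i → u ∈ bag′ j → Walk (TAdj D) (λ l → u ∈ bag′ l) i j
    subtree′ u i j hi hj with toOld hi | toOld hj
    ... | i′ , hi′ , w₁ | j′ , hj′ , w₂ =
      w₁ ++ʷ WalkOps.weaken (⊆bag′ _) (subtree D u i′ j′ hi′ hj′) ++ʷ
      WalkOps.reverse (λ {a} {b} → IsTree.symmetric (isTree D) a b) w₂
      where open WalkOps using (_++ʷ_)

  D′ : TreeDecomposition G
  D′ = record
    { m = m D ; TAdj = TAdj D ; isTree = isTree D ; bag = bag′
    ; covers    = λ u → proj₁ (covers D u) , ⊆bag′ _ (proj₂ (covers D u))
    ; edgeCover = λ a b e → let (l , ha , hb) = edgeCover D a b e in l , ⊆bag′ l ha , ⊆bag′ l hb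
    ; subtree   = subtree′ }

  ∣By′∣≤1+∣By∣ : ∣ bag′ y ∣ ≤ suc ∣ bag D y ∣
  ∣By′∣≤1+∣By∣ = ∣p∣≤1+∣q∣ (bag′ y) (bag D y) v (λ h → forget (old-or-added h))
    where
      forget : ∀ {u} → u ∈ bag D y ⊎ (y ≡ y × u ≡ v) → u ∈ bag D y ⊎ u ≡ v
      forget (inj₁ old)     = inj₁ old
      forget (inj₂ (_ , e)) = inj₂ e

  other-unchanged : ∀ l → l ≢ y → ∣ bag′ l ∣ ≤ ∣ bag D l ∣
  other-unchanged l l≢y = p⊆q⇒∣p∣≤∣q∣ (λ h → old (old-or-added h))
    where
      old : ∀ {u} → u ∈ bag D l ⊎ (l ≡ y × u ≡ v) → u ∈ bag D l
      old (inj₁ h)       = h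
      old (inj₂ (e , _)) = ⊥-elim (l≢y e)

module _ {n} {G : Graph n} where

  totalSize : TreeDecomposition G → ℕ
  totalSize D = sumᶠ (m D) (λ l → ∣ bag D l ∣)

  Full : TreeDecomposition G → ℕ → Set
  Full D k = ∃ λ l → ∣ bag D l ∣ ≡ k + 1

  notFull⇒small : ∀ (D : TreeDecomposition G) {k} → WidthAtMost D k → ¬ Full D k → ∀ l → ∣ bag D l ∣ ≤ k
  notFull⇒small D {k} width notFull l =
    ≤-pred (subst (suc ∣ bag D l ∣ ≤_) (+-comm k 1) (≤∧≢⇒< (width l) (λ e → notFull (l , e))))

  total≤capacity : ∀ (D : TreeDecomposition G) {k} → WidthAtMost D k → totalSize D ≤ m D * (k + 1)
  total≤capacity D {k} width = sumᶠ-bound (m D) _ (k + 1) width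

  total<capacity : ∀ (D : TreeDecomposition G) {k} → (∀ l → ∣ bag D l ∣ ≤ k) → totalSize D < m D * (k + 1)
  total<capacity D {k} small = begin-strict
    totalSize D       ≤⟨ sumᶠ-bound (m D) _ k small ⟩
    m D * k           <⟨ m<m+n (m D * k) (IsTree.nonempty (isTree D)) ⟩
    m D * k + m D     ≡⟨ cong (m D * k +_) (sym (*-identityʳ (m D))) ⟩
    m D * k + m D * 1 ≡⟨ sym (*-distribˡ-+ (m D) k 1) ⟩
    m D * (k + 1)     ∎
    where open ℕP.≤-Reasoning

record Anchored {n} (G : Graph n) (k : ℕ) (W : Subset n) : Set₁ where
  field
    D     : TreeDecomposition G
    width : WidthAtMost D k
    x     : Fin (m D)
    W⊆B   : W ⊆ bag D x

  -- how many vertices can still be added before all bags are full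
  deficit : ℕ
  deficit = m D * (k + 1) ∸ totalSize D

-- While no bag is full, some vertex v lies outside B_x (namely
-- one on a detour around B_x ⊇ {s, t}); adding v to the bag B_y of the first
-- edge yz on a tree walk from x towards a bag containing v keeps width ≤ k
-- and W ⊆ B_x, and decreases the deficit.  Iterating yields width exactly k.
module Padding {n} (G : Graph n) (k : ℕ) (s t : Fin n) (together : AlwaysTogether G k s t)
               (s≢t : s ≢ t) (s≁t : ¬ Adj G s t) (W : Subset n) (s∈W : s ∈ W) (t∈W : t ∈ W) where

  Padded : Set₁
  Padded = Σ (TreeDecomposition G) λ D → WidthEq D k × Σ (Fin (m D)) λ x → W ⊆ bag D x

  addVertex : (a : Anchored G k W) → ¬ Full (Anchored.D a) k →
    ∀ {y z v} → TAdj (Anchored.D a) y z → v ∉ bag (Anchored.D a) y → v ∈ bag (Anchored.D a) z →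
    Σ (Anchored G k W) λ a′ → Anchored.deficit a′ < Anchored.deficit a
  addVertex a notFull {y} {z} {v} y~z v∉By v∈Bz = a′ , ∸-monoʳ-< grows (total≤capacity D′ width′)
    where
      open Anchored a
      open AddToBag D y~z v∈Bz
      width′ : WidthAtMost D′ k
      width′ l = bound (l ≟ y)
        where
          -- (matching on l ≟ y directly would rewrite the decision inside bag′ l)
          bound : Dec (l ≡ y) → ∣ bag′ l ∣ ≤ k + 1
          bound (yes refl) = ≤-trans ∣By′∣≤1+∣By∣
                               (≤-trans (s≤s (notFull⇒small D width notFull y)) (≤-reflexive (+-comm 1 k)))
          bound (no l≢y)   = ≤-trans (other-unchanged l l≢y) (width l)
      a′ : Anchored G k W
      a′ = record { D = D′ ; width = width′ ; x = x ; W⊆B = λ h → ⊆bag′ x (W⊆B h) }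
      grows : totalSize D < totalSize D′
      grows = sumᶠ-strict (m D) _ _ y (λ l → p⊆q⇒∣p∣≤∣q∣ (⊆bag′ l))
                (p⊂q⇒∣p∣<∣q∣ (⊆bag′ y , v , v∈By′ , v∉By))

  addOutside : (a : Anchored G k W) → ¬ Full (Anchored.D a) k →
    ∀ {v} → v ∉ bag (Anchored.D a) (Anchored.x a) →
    Σ (Anchored G k W) λ a′ → Anchored.deficit a′ < Anchored.deficit a
  addOutside a notFull {v} v∉Bx
    with WalkOps.entry (λ l → v ∈? bag D l) (IsTree.connected (isTree D) x (proj₁ (covers D v)))
           v∉Bx (proj₂ (covers D v))
    where open Anchored a
  ... | _ , _ , y~z , v∉By , v∈Bz = addVertex a notFull y~z v∉By v∈Bz

  padStep : (a : Anchored G k W) → ¬ Full (Anchored.D a) k →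
    Σ (Anchored G k W) λ a′ → Anchored.deficit a′ < Anchored.deficit a
  padStep a notFull = addOutside a notFull (Detour.c₁∉B (detourAround G k s t together s≢t s≁t D width x
    (W⊆B s∈W) (W⊆B t∈W)))
    where open Anchored a

  pad : ∀ fuel (a : Anchored G k W) → Anchored.deficit a ≤ fuel → Padded
  pad fuel a bound with any? (λ l → ∣ bag (Anchored.D a) l ∣ ℕP.≟ k + 1)
  ... | yes full = Anchored.D a , (Anchored.width a , full) , Anchored.x a , Anchored.W⊆B a
  pad zero a bound | no notFull =
    ⊥-elim (<-irrefl refl (<-≤-trans (m<n⇒0<n∸m (total<capacity D (notFull⇒small D width notFull))) bound))
    where open Anchored a
  pad (suc fuel) a bound | no notFull with padStep a notFull
  ... | a′ , smaller = pad fuel a′ (≤-pred (<-≤-trans smaller bound))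

singleNode : IsTree {1} (λ _ _ → ⊥)
singleNode = record
  { nonempty  = s≤s z≤n
  ; symmetric = λ _ _ ()
  ; irreflex  = λ _ ()
  ; connected = λ { zero zero → here tt }
  ; acyclic   = λ { (_ , [] , () , _)
                  ; (_ , (_ ∷ []) , s≤s () , _)
                  ; (_ , (_ ∷ _ ∷ _) , _ , _ , () , _) }
  }

SeparatingEdge : ∀ {n} → Graph n → ℕ → Fin n → Fin n → Set₁
SeparatingEdge G k s t = Σ (TreeDecomposition G) λ D → WidthEq D k ×
  ∃ λ i → ∃ λ j → TAdj D i j ×
    (s ∈ (bag D i ∩ bag D j)) × (t ∈ (bag D i ∩ bag D j)) ×
    (∣ bag D i ∩ bag D j ∣ ≤ k) × IsVertexSeparator G (bag D i ∩ bag D j)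

-- Step (3b).  Attaching to x a new leaf with bag W ⊆ B_x keeps a
-- decomposition of width exactly k (as |W| ≤ k), and the new edge has
-- adhesion B_x ∩ W = W.
attachLeaf : ∀ {n} (G : Graph n) (k : ℕ) {s t : Fin n} (D : TreeDecomposition G) → WidthEq D k →
  (x : Fin (m D)) (W : Subset n) → W ⊆ bag D x → s ∈ W → t ∈ W → ∣ W ∣ ≤ k → IsVertexSeparator G W →
  SeparatingEdge G k s t
attachLeaf {n} G k {s} {t} D (width , (l , size)) x W W⊆B s∈W t∈W small separates =
  glued , (width′ , full′) , join (m D) 1 (inj₁ x) , join (m D) 1 (inj₂ zero) , bridge ,
  subst (λ A → (s ∈ A) × (t ∈ A) × (∣ A ∣ ≤ k) × IsVertexSeparator G A) (sym adhesion)
        (s∈W , t∈W , small , separates)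
  where
    open Glue (isTree D) singleNode x zero
    leafSubtree : ∀ v (a b : Fin 1) → v ∈ W → v ∈ W → Walk (λ _ _ → ⊥) (λ _ → v ∈ W) a b
    leafSubtree v zero zero _ h = here h
    open Decomposition G (bag D) (λ _ → W) (subtree D) leafSubtree (λ v a b _ v∈W → W⊆B v∈W , v∈W)
      (λ v → inj₁ (covers D v)) (λ u v e → inj₁ (edgeCover D u v e))

    adhesion : bagᴳ (join (m D) 1 (inj₁ x)) ∩ bagᴳ (join (m D) 1 (inj₂ zero)) ≡ W
    adhesion = trans (cong₂ _∩_ (bagᴳ-join (inj₁ x)) (bagᴳ-join (inj₂ zero)))
                     (⊆-antisym (p∩q⊆q _ _) (λ h → x∈p∩q⁺ (W⊆B h , h)))

    width′ : WidthAtMost glued k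
    width′ i = bound (splitAt (m D) i)
      where
        bound : ∀ u → ∣ bagᴺ u ∣ ≤ k + 1
        bound (inj₁ a) = width a
        bound (inj₂ _) = ≤-trans small (≤-trans (n≤1+n k) (≤-reflexive (+-comm 1 k)))

    full′ : ∃ λ l → ∣ bagᴳ l ∣ ≡ k + 1
    full′ = join (m D) 1 (inj₁ l) , trans (cong ∣_∣ (bagᴳ-join (inj₁ l))) size

mainTheorem12 : (k : ℕ) → 1 ≤ k → (n : ℕ) → (G : Graph n) →
    TreewidthAtMost G k →
    (s t : Fin n) → s ≢ t → ¬ Adj G s t →
    ((D : TreeDecomposition G) → WidthAtMost D k → ∃ λ i → (s ∈ bag D i) × (t ∈ bag D i)) →
    (Σ (TreeDecomposition G) λ D → WidthEq D k ×
      ∃ λ i → ∃ λ j → TAdj D i j ×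
        (s ∈ (bag D i ∩ bag D j)) × (t ∈ (bag D i ∩ bag D j)) ×
        (∣ bag D i ∩ bag D j ∣ ≤ k) × IsVertexSeparator G (bag D i ∩ bag D j))
    × (Σ (Subset n) λ W → (s ∈ W) × (t ∈ W) × (∣ W ∣ ≤ k) × IsVertexSeparator G W)
mainTheorem12 k _ n G (D₀ , width₀) s t s≢t s≁t together =
  attachLeaf G k padded full x′ W W⊆B′ s∈W t∈W small separates ,
  (W , s∈W , t∈W , small , separates)
  where
    open SeparatorInBag (separatorInBag G k s t together s≢t s≁t D₀ width₀)
    start : Anchored G k W
    start = record { D = D₀ ; width = width₀ ; x = x ; W⊆B = W⊆B }
    open Padding G k s t together s≢t s≁t W s∈W t∈W
    padding : Padded
    padding = pad (Anchored.deficit start) start ≤-refl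
    padded : TreeDecomposition G
    padded = proj₁ padding
    full : WidthEq padded k
    full = proj₁ (proj₂ padding)
    x′ : Fin (m padded)
    x′ = proj₁ (proj₂ (proj₂ padding))
    W⊆B′ : W ⊆ bag padded x′
    W⊆B′ = proj₂ (proj₂ (proj₂ padding))
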